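{- Let $G$ be a binary quasigroup of order $n$. Then for each tuple $V\in\mathcal I_n^n$ and all $a,i\in\mathcal I_n$ there exist $b\in\mathcal I_n$ and an integer $k\ge0$ such that there is a $V$-diagonal of type $\mathbf a_i(b)$ in $G[2k]$.
   Context: Let $\mathcal I_n=\{1,\dots,n\}$. A binary quasigroup $G$ of order $n$ is the set $\mathcal I_n$ with an operation $*$ such that for all $a_0,a_1,a_2$ there are unique $x_1,x_2$ with $a_1*x_2=a_0$ and $x_1*a_2=a_0$. Elements of $\mathcal I_n^n$ are tuples; $*$ acts on tuples entrywise. A permutation is a tuple with pairwise distinct entries; $\mathcal W$ is the set of permutations. For $d\ge0$, a $U$-diagonal of type $V$ in the $d$-iterated quasigroup $G[d]$ is a sequence $(W_1,\dots,W_d)\in\mathcal W^d$ with $(\cdots((U*W_1)*W_2)*\cdots)*W_d=V$ entrywise (for $d=0$ this means $U=V$). For $a,b,i\in\mathcal I_n$, $\mathbf a_i(b)$ denotes the tuple all of whose entries equal $a$ except the $i$-th, which equals $b$ (possibly $b=a$). -}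

module Defs where

open import Data.Nat using (ℕ)
open import Data.Fin using (Fin; _≟_)
open import Data.Product using (Σ; _×_)
open import Data.Vec using (Vec; foldl)
open import Data.Vec.Relation.Unary.All using (All)
open import Relation.Binary.PropositionalEquality using (_≡_)
open import Relation.Nullary using (yes; no)

-- I_n is represented by Fin n.
Op : ℕ → Set
Op n = Fin n → Fin n → Fin n

record IsQuasigroup {n : ℕ} (_*_ : Op n) : Set where
  field
    right-solve  : (a₀ a₁ : Fin n) → Σ (Fin n) (λ x₂ → a₁ * x₂ ≡ a₀)
    right-unique : (a₀ a₁ x y : Fin n) → a₁ * x ≡ a₀ → a₁ * y ≡ a₀ → x ≡ y
    left-solve   : (a₀ a₂ : Fin n) → Σ (Fin n) (λ x₁ → x₁ * a₂ ≡ a₀)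
    left-unique  : (a₀ a₂ x y : Fin n) → x * a₂ ≡ a₀ → y * a₂ ≡ a₀ → x ≡ y

Tuple : ℕ → Set
Tuple n = Fin n → Fin n

_⊛_ : {n : ℕ} → Op n → Tuple n → Tuple n → Tuple n
(_*_ ⊛ U) W j = U j * W j

IsPermutation : {n : ℕ} → Tuple n → Set
IsPermutation {n} W = (i j : Fin n) → W i ≡ W j → i ≡ j

iterate : {n d : ℕ} → Op n → Tuple n → Vec (Tuple n) d → Tuple n
iterate _*_ U Ws = foldl _ (_⊛_ _*_) U Ws

Diagonal : {n : ℕ} → Op n → (d : ℕ) → Tuple n → Tuple n → Set
Diagonal {n} _*_ d U V =
  Σ (Vec (Tuple n) d) λ Ws → All IsPermutation Ws × ((j : Fin n) → iterate _*_ U Ws j ≡ V j)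

unitTuple : {n : ℕ} → Fin n → Fin n → Fin n → Tuple n
unitTuple a i b j with j ≟ i
... | yes _ = b
... | no  _ = a

-- Right multiplication by any w is a permutation of the n symbols, so there is one e with
-- (_∘ w) ^ (e + 1) = id for every w.  Applying a permutation tuple W' exactly 2e + 1 times
-- therefore divides every entry on the right by the matching entry of W'; preceded by one
-- step with a permutation tuple W this gives an even diagonal from X to (X ⊛ W) / W'.
-- Given j ≢ i, solve X j ∘ u = a ∘ j and take W' = (i u), W = (i u)(i j): the entry j
-- becomes (a ∘ j) / j = a, and every entry other than i and j is multiplied and divided by
-- the same symbol.  Doing this for every j ≢ i yields a tuple of the form a_i(b).
module Submission where

open import Defs
open import Data.Nat using (ℕ; _*_)
open import Data.Fin using (Fin)
open import Data.Product using (Σ)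

open import Data.Nat using (zero; suc; _+_)
open import Data.Nat.Properties using (+-comm; +-suc; *-suc; *-distribˡ-+; n<1+n; m≤n⇒∃[o]m+o≡n)
open import Data.Nat.Divisibility using (_∣_; divides; ∣-trans; m∣m*n; n∣m*n)
open import Data.Fin using (toℕ; _≟_)
open import Data.Fin.Properties using (pigeonhole)
open import Data.Fin.Permutation.Components using (transpose; transpose-inverse)
open import Data.Product using (∃; _×_; _,_; proj₁; proj₂)
open import Data.Vec using (Vec; []; _∷_; _++_)
open import Data.Vec.Relation.Unary.All using ([]; _∷_)
open import Data.Vec.Relation.Unary.All.Properties using (++⁺)
open import Data.List using (List; []; _∷_; allFin)
open import Data.List.Relation.Unary.All as List using ([]; _∷_)
open import Data.List.Membership.Propositional.Properties using (∈-allFin)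
open import Function.Definitions using (Injective)
open import Relation.Nullary using (yes; no; contradiction)
open import Relation.Binary.PropositionalEquality

module _ {A : Set} where
  open import Function.Endo.Propositional A using (_^_; ^-homo)

  ^-suc-comm : ∀ (f : A → A) m x → (f ^ m) (f x) ≡ (f ^ suc m) x
  ^-suc-comm f m x = begin
    (f ^ m) (f x)     ≡⟨ cong-app (^-homo f m 1) x ⟨
    (f ^ (m + 1)) x   ≡⟨ cong (λ k → (f ^ k) x) (+-comm m 1) ⟩
    (f ^ suc m) x     ∎
    where open ≡-Reasoning

  ^-injective : ∀ {f : A → A} → Injective _≡_ _≡_ f → ∀ m → Injective _≡_ _≡_ (f ^ m)
  ^-injective f-inj zero    eq = eq
  ^-injective f-inj (suc m) eq = ^-injective f-inj m (f-inj eq)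

  ^-periodic : ∀ (f : A → A) {p q} x → (f ^ p) x ≡ x → p ∣ q → (f ^ q) x ≡ x
  ^-periodic f {p} x fᵖx≡x (divides c refl) = go c
    where
    go : ∀ c → (f ^ (c * p)) x ≡ x
    go zero    = refl
    go (suc c) = begin
      (f ^ (p + c * p)) x        ≡⟨ cong-app (^-homo f p (c * p)) x ⟩
      (f ^ p) ((f ^ (c * p)) x)  ≡⟨ cong (f ^ p) (go c) ⟩
      (f ^ p) x                  ≡⟨ fᵖx≡x ⟩
      x                          ∎
      where open ≡-Reasoning

common-multiple : ∀ {m} (p : Fin m → ℕ) → ∃ λ N → ∀ k → suc (p k) ∣ suc N
common-multiple {zero}  p = 0 , λ ()
common-multiple {suc m} p with N , p∣N ← common-multiple (λ k → p (Fin.suc k)) =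
  N + p Fin.zero * suc N , λ
    { Fin.zero    → m∣m*n (suc N)
    ; (Fin.suc k) → ∣-trans (p∣N k) (n∣m*n (suc (p Fin.zero)))
    }

module _ {n : ℕ} where
  open import Function.Endo.Propositional (Fin n) using (_^_; ^-homo)

  injective⇒periodic : ∀ {f : Fin n → Fin n} → Injective _≡_ _≡_ f →
                       ∀ y → ∃ λ m → (f ^ suc m) y ≡ y
  injective⇒periodic {f} f-inj y
    with i , j , i<j , fⁱy≡fʲy ← pigeonhole (n<1+n n) (λ t → (f ^ toℕ t) y)
    with o , i+1+o≡j ← m≤n⇒∃[o]m+o≡n i<j
    = o , ^-injective f-inj (toℕ i) (begin
      (f ^ toℕ i) ((f ^ suc o) y) ≡⟨ cong-app (^-homo f (toℕ i) (suc o)) y ⟨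
      (f ^ (toℕ i + suc o)) y     ≡⟨ cong (λ k → (f ^ k) y) (trans (+-suc (toℕ i) o) i+1+o≡j) ⟩
      (f ^ toℕ j) y               ≡⟨ fⁱy≡fʲy ⟨
      (f ^ toℕ i) y               ∎)
    where open ≡-Reasoning

  injective⇒finite-order : ∀ {f : Fin n → Fin n} → Injective _≡_ _≡_ f →
                           ∃ λ e → ∀ y → (f ^ suc e) y ≡ y
  injective⇒finite-order {f} f-inj =
    proj₁ common , λ y → ^-periodic f y (proj₂ (periodic y)) (proj₂ common y)
    where
    periodic : ∀ y → ∃ λ m → (f ^ suc m) y ≡ y
    periodic = injective⇒periodic f-inj
    common : ∃ λ e → ∀ y → suc (proj₁ (periodic y)) ∣ suc e
    common = common-multiple (λ y → proj₁ (periodic y))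

module _ {n : ℕ} (_∘_ : Op n) where
  open import Function.Endo.Propositional (Fin n) using (_^_)

  iterate-++ : ∀ {d₁ d₂} U (Ws₁ : Vec (Tuple n) d₁) (Ws₂ : Vec (Tuple n) d₂) →
               iterate _∘_ U (Ws₁ ++ Ws₂) ≡ iterate _∘_ (iterate _∘_ U Ws₁) Ws₂
  iterate-++ U []        Ws₂ = refl
  iterate-++ U (W ∷ Ws₁) Ws₂ = iterate-++ ((_∘_ ⊛ U) W) Ws₁ Ws₂

  iterate-cong : ∀ {d U U'} (Ws : Vec (Tuple n) d) → U ≗ U' → iterate _∘_ U Ws ≗ iterate _∘_ U' Ws
  iterate-cong []       U≗U' = U≗U'
  iterate-cong (W ∷ Ws) U≗U' = iterate-cong Ws (λ j → cong (_∘ W j) (U≗U' j))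

  diagonal-retarget : ∀ {d U V V'} → Diagonal _∘_ d U V → V ≗ V' → Diagonal _∘_ d U V'
  diagonal-retarget (Ws , Ws-perm , eq) V≗V' = Ws , Ws-perm , λ j → trans (eq j) (V≗V' j)

  diagonal-∷ : ∀ {d U V W} → IsPermutation W → Diagonal _∘_ d ((_∘_ ⊛ U) W) V → Diagonal _∘_ (suc d) U V
  diagonal-∷ W-perm (Ws , Ws-perm , eq) = _ ∷ Ws , W-perm ∷ Ws-perm , eq

  diagonal-++ : ∀ {d₁ d₂ U V Z} → Diagonal _∘_ d₁ U V → Diagonal _∘_ d₂ V Z → Diagonal _∘_ (d₁ + d₂) U Z
  diagonal-++ {U = U} (Ws₁ , Ws₁-perm , eq₁) (Ws₂ , Ws₂-perm , eq₂) =
    Ws₁ ++ Ws₂ , ++⁺ Ws₁-perm Ws₂-perm ,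
    λ j → trans (cong (λ T → T j) (iterate-++ U Ws₁ Ws₂)) (trans (iterate-cong Ws₂ eq₁ j) (eq₂ j))

  diagonal-replicate : ∀ {W} → IsPermutation W → ∀ m U →
                       Diagonal _∘_ m U (λ j → ((_∘ W j) ^ m) (U j))
  diagonal-replicate W-perm zero    U = [] , [] , λ j → refl
  diagonal-replicate {W} W-perm (suc m) U =
    diagonal-∷ W-perm (diagonal-retarget (diagonal-replicate W-perm m ((_∘_ ⊛ U) W))
                                         (λ j → ^-suc-comm (_∘ W j) m (U j)))

  EvenDiagonal : Tuple n → Tuple n → Set
  EvenDiagonal U V = Σ ℕ λ k → Diagonal _∘_ (2 * k) U V

  ≗⇒evenDiagonal : ∀ {U V} → U ≗ V → EvenDiagonal U V
  ≗⇒evenDiagonal U≗V = 0 , [] , [] , U≗V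

  evenDiagonal-trans : ∀ {U V Z} → EvenDiagonal U V → EvenDiagonal V Z → EvenDiagonal U Z
  evenDiagonal-trans {U} {Z = Z} (k₁ , D₁) (k₂ , D₂) =
    k₁ + k₂ , subst (λ d → Diagonal _∘_ d U Z) (sym (*-distribˡ-+ 2 k₁ k₂)) (diagonal-++ D₁ D₂)

module _ {n : ℕ} (i j : Fin n) where

  transpose-matchˡ : transpose i j i ≡ j
  transpose-matchˡ with i ≟ i
  ... | yes _   = refl
  ... | no i≢i  = contradiction refl i≢i

  transpose-matchʳ : transpose i j j ≡ i
  transpose-matchʳ with j ≟ i
  ... | yes j≡i = j≡i
  ... | no _ with j ≟ j
  ...   | yes _   = refl
  ...   | no j≢j  = contradiction refl j≢j

  transpose-other : ∀ {k} → k ≢ i → k ≢ j → transpose i j k ≡ k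
  transpose-other {k} k≢i k≢j with k ≟ i
  ... | yes k≡i = contradiction k≡i k≢i
  ... | no _ with k ≟ j
  ...   | yes k≡j = contradiction k≡j k≢j
  ...   | no _    = refl

  transpose-injective : Injective _≡_ _≡_ (transpose i j)
  transpose-injective {x} {y} eq = begin
    x                                   ≡⟨ transpose-inverse j i ⟨
    transpose j i (transpose i j x)     ≡⟨ cong (transpose j i) eq ⟩
    transpose j i (transpose i j y)     ≡⟨ transpose-inverse j i ⟩
    y                                   ∎
    where open ≡-Reasoning

≗-unitTuple : ∀ {n} {a i : Fin n} {Y : Tuple n} → (∀ k → k ≢ i → Y k ≡ a) → Y ≗ unitTuple a i (Y i)
≗-unitTuple {i = i} Y≡a k with k ≟ i
... | yes refl = refl
... | no k≢i   = Y≡a k k≢i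

module _ {n : ℕ} {_∘_ : Op n} (quasigroup : IsQuasigroup _∘_) where
  open IsQuasigroup quasigroup
  open import Function.Endo.Propositional (Fin n) using (_^_)

  infixl 7 _/_
  _/_ : Fin n → Fin n → Fin n
  x / w = proj₁ (left-solve x w)

  /-∘ : ∀ x w → (x / w) ∘ w ≡ x
  /-∘ x w = proj₂ (left-solve x w)

  /-unique : ∀ {t w x} → t ∘ w ≡ x → t ≡ x / w
  /-unique {t} {w} {x} t∘w≡x = left-unique x w t (x / w) t∘w≡x (/-∘ x w)

  ∘-/ : ∀ x w → (x ∘ w) / w ≡ x
  ∘-/ x w = sym (/-unique refl)

  ∘-cancelʳ : ∀ w → Injective _≡_ _≡_ (_∘ w)
  ∘-cancelʳ w {x} {y} x∘w≡y∘w = left-unique (y ∘ w) w x y x∘w≡y∘w refl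

  rightMul-exponent : ∃ λ E → ∀ w x → ((_∘ w) ^ suc E) x ≡ x
  rightMul-exponent = proj₁ common , λ w x → ^-periodic (_∘ w) x (proj₂ (order w) x) (proj₂ common w)
    where
    order : ∀ w → ∃ λ e → ∀ x → ((_∘ w) ^ suc e) x ≡ x
    order w = injective⇒finite-order (∘-cancelʳ w)
    common : ∃ λ E → ∀ w → suc (proj₁ (order w)) ∣ suc E
    common = common-multiple (λ w → proj₁ (order w))

  E : ℕ
  E = proj₁ rightMul-exponent

  diagonal-/ : ∀ {W} → IsPermutation W → ∀ S → Diagonal _∘_ (suc (2 * E)) S (λ k → S k / W k)
  diagonal-/ {W} W-perm S = diagonal-retarget _∘_ (diagonal-replicate _∘_ W-perm (suc (2 * E)) S) returns
    where
    returns : ∀ k → ((_∘ W k) ^ suc (2 * E)) (S k) ≡ S k / W k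
    returns k = begin
      (f ^ suc (2 * E)) (S k)            ≡⟨ cong (f ^ suc (2 * E)) (/-∘ (S k) (W k)) ⟨
      (f ^ suc (2 * E)) (f (S k / W k))  ≡⟨ ^-suc-comm f (suc (2 * E)) (S k / W k) ⟩
      (f ^ (2 + 2 * E)) (S k / W k)      ≡⟨ ^-periodic f {suc E} (S k / W k) (proj₂ rightMul-exponent (W k) _)
                                                                  (divides 2 (sym (*-suc 2 E))) ⟩
      S k / W k                          ∎
      where
      open ≡-Reasoning
      f = _∘ W k

  evenDiagonal-/ : ∀ {W W'} → IsPermutation W → IsPermutation W' → ∀ X →
                   EvenDiagonal _∘_ X (λ k → (X k ∘ W k) / W' k)
  evenDiagonal-/ {W} {W'} W-perm W'-perm X =
    suc E , subst (λ d → Diagonal _∘_ d X (λ k → (X k ∘ W k) / W' k)) (sym (*-suc 2 E))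
                  (diagonal-∷ _∘_ W-perm (diagonal-/ W'-perm _))

  module _ (a i : Fin n) where

    fix-coordinate : ∀ {j} → j ≢ i → (X : Tuple n) →
                     ∃ λ Y → EvenDiagonal _∘_ X Y × Y j ≡ a × (∀ k → k ≢ i → k ≢ j → Y k ≡ X k)
    fix-coordinate {j} j≢i X with u , Xj∘u≡a∘j ← right-solve (a ∘ j) (X j) | u ≟ j
    ... | yes refl = X , ≗⇒evenDiagonal _∘_ (λ _ → refl) , ∘-cancelʳ j Xj∘u≡a∘j , λ _ _ _ → refl
    ... | no u≢j   = _ , evenDiagonal-/ W-perm W'-perm X , Yj≡a , Yk≡Xk
      where
      open ≡-Reasoning
      W' W : Tuple n
      W' = transpose i u
      W k = transpose i u (transpose i j k)

      W'-perm : IsPermutation W'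
      W'-perm _ _ = transpose-injective i u

      W-perm : IsPermutation W
      W-perm _ _ Wx≡Wy = transpose-injective i j (transpose-injective i u Wx≡Wy)

      Yj≡a : (X j ∘ W j) / W' j ≡ a
      Yj≡a = begin
        (X j ∘ W j) / W' j  ≡⟨ cong₂ (λ w w' → (X j ∘ w) / w') Wj≡u W'j≡j ⟩
        (X j ∘ u) / j       ≡⟨ cong (_/ j) Xj∘u≡a∘j ⟩
        (a ∘ j) / j         ≡⟨ ∘-/ a j ⟩
        a                   ∎
        where
        Wj≡u : W j ≡ u
        Wj≡u = trans (cong (transpose i u) (transpose-matchʳ i j)) (transpose-matchˡ i u)
        W'j≡j : W' j ≡ j
        W'j≡j = transpose-other i u j≢i (λ j≡u → u≢j (sym j≡u))

      Yk≡Xk : ∀ k → k ≢ i → k ≢ j → (X k ∘ W k) / W' k ≡ X k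
      Yk≡Xk k k≢i k≢j = begin
        (X k ∘ W k) / W' k   ≡⟨ cong (λ w → (X k ∘ transpose i u w) / W' k) (transpose-other i j k≢i k≢j) ⟩
        (X k ∘ W' k) / W' k  ≡⟨ ∘-/ (X k) (W' k) ⟩
        X k                  ∎

    fix-coordinates : (L : List (Fin n)) (X : Tuple n) →
                      ∃ λ Y → EvenDiagonal _∘_ X Y × List.All (λ k → k ≢ i → Y k ≡ a) L
    fix-coordinates []      X = X , ≗⇒evenDiagonal _∘_ (λ _ → refl) , []
    fix-coordinates (j ∷ L) X with Y , X⇝Y , Y≡a ← fix-coordinates L X | j ≟ i
    ... | yes refl = Y , X⇝Y , (λ i≢i → contradiction refl i≢i) ∷ Y≡a
    ... | no j≢i with Z , Y⇝Z , Zj≡a , Z≡Y ← fix-coordinate j≢i Y =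
      Z , evenDiagonal-trans _∘_ X⇝Y Y⇝Z , (λ _ → Zj≡a) ∷ List.map keep Y≡a
      where
      keep : ∀ {k} → (k ≢ i → Y k ≡ a) → k ≢ i → Z k ≡ a
      keep {k} Yk≡a k≢i with k ≟ j
      ... | yes refl = Zj≡a
      ... | no k≢j   = trans (Z≡Y k k≢i k≢j) (Yk≡a k≢i)

proposition1 : (n : ℕ) (_∘_ : Op n) → IsQuasigroup _∘_ →
    (V : Tuple n) (a i : Fin n) →
    Σ (Fin n) λ b → Σ ℕ λ k → Diagonal _∘_ (2 * k) V (unitTuple a i b)
proposition1 n _∘_ quasigroup V a i with Y , V⇝Y , Y≡a ← fix-coordinates quasigroup a i (allFin n) V =
  Y i , evenDiagonal-trans _∘_ V⇝Y (≗⇒evenDiagonal _∘_ (≗-unitTuple (λ k → List.lookup Y≡a (∈-allFin k))))
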